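{- Let $G$ be a subcubic graph of order $n\ge 5$ with vertex set $V$, and let $D_1,D_2,D_3\subseteq V$ be three pairwise disjoint connected dominating sets in $G$. Then $|D_1|=|D_2|=|D_3|=2$ and $G$ is isomorphic to the prism $Pr_6$ or to the Möbius ladder $M_6\cong K_{3,3}$.
   Context: Graphs are finite and simple. A graph is subcubic if it is connected and its maximum vertex degree is at most 3. $G[S]$ denotes the subgraph induced by $S$. A set $D\subseteq V$ is dominating if every vertex of $V\setminus D$ has a neighbour in $D$; it is a connected dominating set if moreover $G[D]$ is connected. $Pr_6$ is the triangular prism ($C_3\times K_2$: two disjoint triangles joined by a perfect matching between corresponding vertices). The Möbius ladder $M_n$ ($n$ even) is obtained from the cycle $C_n$ by adding edges joining each pair of opposite vertices; $M_6\cong K_{3,3}$. -}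

module Defs where

open import Data.Nat using (ℕ; zero; suc; _+_; _≤_; _<_; _%_)
open import Data.Bool using (Bool; true; false; _∧_; _∨_; not; if_then_else_)
open import Data.Fin using (Fin; toℕ)
open import Data.Fin.Subset using (Subset; _∈_; _∉_; ∣_∣)
open import Data.List using (List; map)
open import Data.Nat.ListAction using (sum)
open import Data.List using (allFin)
open import Data.Product using (Σ; ∃; _×_; _,_)
open import Relation.Binary.PropositionalEquality using (_≡_)
open import Relation.Nullary using (¬_)
open import Function.Bundles using (_↔_; Inverse)
open import Data.Nat using (_≡ᵇ_; _<ᵇ_)

record Graph (n : ℕ) : Set where
  field
    adj   : Fin n → Fin n → Bool
    sym   : ∀ u v → adj u v ≡ adj v u
    irrefl : ∀ v → adj v v ≡ false
open Graph public

degree : ∀ {n} → Graph n → Fin n → ℕ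
degree {n} G v = sum (map (λ u → if adj G v u then 1 else 0) (allFin n))

data WalkIn {n : ℕ} (G : Graph n) (S : Subset n) : Fin n → Fin n → Set where
  here : ∀ {v} → v ∈ S → WalkIn G S v v
  step : ∀ {u w v} → u ∈ S → adj G u w ≡ true → WalkIn G S w v → WalkIn G S u v

InducedConnected : ∀ {n} → Graph n → Subset n → Set
InducedConnected G S = ∀ u v → u ∈ S → v ∈ S → WalkIn G S u v

full : ∀ {n} → Subset n
full = Data.Fin.Subset.⊤
  where import Data.Fin.Subset

Connected : ∀ {n} → Graph n → Set
Connected {n} G = InducedConnected G (full {n})

Subcubic : ∀ {n} → Graph n → Set
Subcubic {n} G = Connected G × (∀ v → degree G v ≤ 3)

Dominating : ∀ {n} → Graph n → Subset n → Set
Dominating G D = ∀ v → v ∉ D → ∃ λ u → u ∈ D × adj G v u ≡ true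

ConnectedDominating : ∀ {n} → Graph n → Subset n → Set
ConnectedDominating G D = Dominating G D × InducedConnected G D

Disjoint : ∀ {n} → Subset n → Subset n → Set
Disjoint A B = ∀ v → v ∈ A → v ∉ B

record _≅_ {n m : ℕ} (G : Graph n) (H : Graph m) : Set where
  field
    bij : Fin n ↔ Fin m
    preserves : ∀ u v → adj H (Inverse.to bij u) (Inverse.to bij v) ≡ adj G u v

-- Triangular prism Pr6 = C3 × K2: triangles {0,1,2} and {3,4,5}, matching i -- i+3
prismAdj : ℕ → ℕ → Bool
prismAdj i j =
  (not (i ≡ᵇ j) ∧ (((i <ᵇ 3) ∧ (j <ᵇ 3)) ∨ (not (i <ᵇ 3) ∧ not (j <ᵇ 3))))
  ∨ ((i + 3) ≡ᵇ j) ∨ ((j + 3) ≡ᵇ i)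

Pr6 : Graph 6
Pr6 = record
  { adj = λ u v → prismAdj (toℕ u) (toℕ v)
  ; sym = symP
  ; irrefl = irr }
  where
  symP : ∀ u v → prismAdj (toℕ u) (toℕ v) ≡ prismAdj (toℕ v) (toℕ u)
  symP u v = aux u v
    where
    open import Data.Fin.Patterns
    aux : ∀ (u v : Fin 6) → prismAdj (toℕ u) (toℕ v) ≡ prismAdj (toℕ v) (toℕ u)
    aux 0F 0F = _≡_.refl
    aux 0F 1F = _≡_.refl
    aux 0F 2F = _≡_.refl
    aux 0F 3F = _≡_.refl
    aux 0F 4F = _≡_.refl
    aux 0F 5F = _≡_.refl
    aux 1F 0F = _≡_.refl
    aux 1F 1F = _≡_.refl
    aux 1F 2F = _≡_.refl
    aux 1F 3F = _≡_.refl
    aux 1F 4F = _≡_.refl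
    aux 1F 5F = _≡_.refl
    aux 2F 0F = _≡_.refl
    aux 2F 1F = _≡_.refl
    aux 2F 2F = _≡_.refl
    aux 2F 3F = _≡_.refl
    aux 2F 4F = _≡_.refl
    aux 2F 5F = _≡_.refl
    aux 3F 0F = _≡_.refl
    aux 3F 1F = _≡_.refl
    aux 3F 2F = _≡_.refl
    aux 3F 3F = _≡_.refl
    aux 3F 4F = _≡_.refl
    aux 3F 5F = _≡_.refl
    aux 4F 0F = _≡_.refl
    aux 4F 1F = _≡_.refl
    aux 4F 2F = _≡_.refl
    aux 4F 3F = _≡_.refl
    aux 4F 4F = _≡_.refl
    aux 4F 5F = _≡_.refl
    aux 5F 0F = _≡_.refl
    aux 5F 1F = _≡_.refl
    aux 5F 2F = _≡_.refl
    aux 5F 3F = _≡_.refl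
    aux 5F 4F = _≡_.refl
    aux 5F 5F = _≡_.refl
  irr : ∀ v → prismAdj (toℕ v) (toℕ v) ≡ false
  irr v = aux v
    where
    open import Data.Fin.Patterns
    aux : ∀ (v : Fin 6) → prismAdj (toℕ v) (toℕ v) ≡ false
    aux 0F = _≡_.refl
    aux 1F = _≡_.refl
    aux 2F = _≡_.refl
    aux 3F = _≡_.refl
    aux 4F = _≡_.refl
    aux 5F = _≡_.refl

-- Möbius ladder M6: cycle 0-1-2-3-4-5-0 plus the chords joining opposite vertices,
-- i.e. i ~ j iff (i - j) mod 6 ∈ {1, 3, 5}
mobiusAdj : ℕ → ℕ → Bool
mobiusAdj i j =
  (((i + 1) % 6) ≡ᵇ j) ∨ (((j + 1) % 6) ≡ᵇ i) ∨ (((i + 3) % 6) ≡ᵇ j)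

M6 : Graph 6
M6 = record
  { adj = λ u v → mobiusAdj (toℕ u) (toℕ v)
  ; sym = symM
  ; irrefl = irr }
  where
  open import Data.Fin.Patterns
  symM : ∀ (u v : Fin 6) → mobiusAdj (toℕ u) (toℕ v) ≡ mobiusAdj (toℕ v) (toℕ u)
  symM 0F 0F = _≡_.refl
  symM 0F 1F = _≡_.refl
  symM 0F 2F = _≡_.refl
  symM 0F 3F = _≡_.refl
  symM 0F 4F = _≡_.refl
  symM 0F 5F = _≡_.refl
  symM 1F 0F = _≡_.refl
  symM 1F 1F = _≡_.refl
  symM 1F 2F = _≡_.refl
  symM 1F 3F = _≡_.refl
  symM 1F 4F = _≡_.refl
  symM 1F 5F = _≡_.refl
  symM 2F 0F = _≡_.refl
  symM 2F 1F = _≡_.refl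
  symM 2F 2F = _≡_.refl
  symM 2F 3F = _≡_.refl
  symM 2F 4F = _≡_.refl
  symM 2F 5F = _≡_.refl
  symM 3F 0F = _≡_.refl
  symM 3F 1F = _≡_.refl
  symM 3F 2F = _≡_.refl
  symM 3F 3F = _≡_.refl
  symM 3F 4F = _≡_.refl
  symM 3F 5F = _≡_.refl
  symM 4F 0F = _≡_.refl
  symM 4F 1F = _≡_.refl
  symM 4F 2F = _≡_.refl
  symM 4F 3F = _≡_.refl
  symM 4F 4F = _≡_.refl
  symM 4F 5F = _≡_.refl
  symM 5F 0F = _≡_.refl
  symM 5F 1F = _≡_.refl
  symM 5F 2F = _≡_.refl
  symM 5F 3F = _≡_.refl
  symM 5F 4F = _≡_.refl
  symM 5F 5F = _≡_.refl
  irr : ∀ (v : Fin 6) → mobiusAdj (toℕ v) (toℕ v) ≡ false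
  irr 0F = _≡_.refl
  irr 1F = _≡_.refl
  irr 2F = _≡_.refl
  irr 3F = _≡_.refl
  irr 4F = _≡_.refl
  irr 5F = _≡_.refl

{-# OPTIONS --safe #-}
-- A vertex v of D i has a neighbour in every D j: for j ≢ i because D j dominates v, and for
-- j ≡ i because otherwise D i = {v} and v would be adjacent to all n - 1 ≥ 4 other vertices.
-- As deg v ≤ 3, these are all neighbours of v, one in each D j. So G[D i] is connected of
-- maximum degree 1, i.e. a single edge, and every vertex lies in some D i: G is cubic on six
-- vertices a, a' ∈ D₁, b, b' ∈ D₂, c, c' ∈ D₃. Between two of these pairs the edges form a
-- perfect matching; fixing the edges a b and b c, the pairs D₁, D₃ are matched either as
-- a c, a' c' (the prism) or as a c', a' c (the Möbius ladder).
module Submission where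

open import Defs hiding (sym)
open import Data.Bool using (Bool; true; false; if_then_else_)
open import Data.Bool.Properties using (⇔→≡) renaming (_≟_ to _≟ᵇ_)
open import Data.Empty using (⊥-elim)
open import Data.Fin using (Fin; zero; suc; _≟_; fromℕ<; combine; remQuot)
open import Data.Fin.Properties
  using (any?; all?; 0≢1+n; suc-injective; remQuot-combine; combine-remQuot)
open import Data.Fin.Patterns using (0F; 1F; 2F; 3F; 4F; 5F)
open import Data.Fin.Subset
  using (Subset; inside; outside; _∈_; _⊆_; ∣_∣; _∪_; _-_; ⁅_⁆; ∁; Nonempty)
open import Data.Fin.Subset.Properties
  using (x∈p⇒∣p-x∣<∣p∣; x∈p∧x≢y⇒x∈p-y; ∣p∣≤∣x∷p∣; ∣⁅x⁆∣≡1; p⊆q⇒∣p∣≤∣q∣; ∣∁p∣≡n∸∣p∣;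
         x∈∁p⇒x∉p; x∈p∪q⁺; x∈⁅y⁆⇔x≡y; _∈?_)
import Data.List as List
open import Data.List.Properties using (map-tabulate)
open import Data.Nat using (ℕ; zero; suc; _≥_; _+_; _∸_; _≤_; _≤?_; z≤n; s≤s)
open import Data.Nat.ListAction using (sum)
open import Data.Nat.Properties
  using (≤-trans; ≤-<-trans; ≤-reflexive; ≤-antisym; ∸-monoˡ-≤; +-suc; +-monoʳ-≤; n≮n;
         module ≤-Reasoning)
open import Data.Product using (∃; _×_; _,_; proj₁; proj₂; uncurry)
open import Data.Sum using (_⊎_; inj₁; inj₂; [_,_]′)
import Data.Sum as Sum
open import Data.Vec using (_∷_; []; tabulate)
open import Data.Vec.Functional using () renaming (_∷_ to _◂_; [] to ◆)
open import Data.Vec.Properties using (lookup∘tabulate; lookup⇒[]=)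
open import Function using (_∘_; id)
open import Function.Bundles using (Equivalence; mk⇔; mk↔ₛ′)
open import Function.Definitions using (Injective)
open import Relation.Binary.PropositionalEquality
  using (_≡_; _≢_; refl; sym; trans; cong; cong₂; subst; module ≡-Reasoning)
open import Relation.Nullary using (yes; no; ¬?)
open import Relation.Nullary.Decidable
  using (Dec; _×-dec_; _→-dec_; map′; from-yes; decidable-stable)

private
  variable
    k n : ℕ

injective⇒≤∣p∣ : {p : Subset n} (ν : Fin k → Fin n) → Injective _≡_ _≡_ ν → (∀ j → ν j ∈ p) →
                 k ≤ ∣ p ∣
injective⇒≤∣p∣ {k = zero} ν _ _ = z≤n
injective⇒≤∣p∣ {k = suc k} ν ν-inj ν∈p =
  ≤-<-trans (injective⇒≤∣p∣ (ν ∘ suc) (suc-injective ∘ ν-inj) ν∘suc∈p-ν0) (x∈p⇒∣p-x∣<∣p∣ (ν∈p zero))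
  where
  ν∘suc∈p-ν0 : ∀ j → ν (suc j) ∈ _ - ν zero
  ν∘suc∈p-ν0 j = x∈p∧x≢y⇒x∈p-y (ν∈p (suc j)) (0≢1+n ∘ sym ∘ ν-inj)

∣p∪q∣≤∣p∣+∣q∣ : (p q : Subset n) → ∣ p ∪ q ∣ ≤ ∣ p ∣ + ∣ q ∣
∣p∪q∣≤∣p∣+∣q∣ []            []            = z≤n
∣p∪q∣≤∣p∣+∣q∣ (inside  ∷ p) (y       ∷ q) =
  s≤s (≤-trans (∣p∪q∣≤∣p∣+∣q∣ p q) (+-monoʳ-≤ ∣ p ∣ (∣p∣≤∣x∷p∣ y q)))
∣p∪q∣≤∣p∣+∣q∣ (outside ∷ p) (inside  ∷ q) =
  ≤-trans (s≤s (∣p∪q∣≤∣p∣+∣q∣ p q)) (≤-reflexive (sym (+-suc ∣ p ∣ ∣ q ∣)))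
∣p∪q∣≤∣p∣+∣q∣ (outside ∷ p) (outside ∷ q) = ∣p∪q∣≤∣p∣+∣q∣ p q

∣p∣≡2 : {p : Subset n} {x y : Fin n} → x ≢ y → x ∈ p → y ∈ p → (∀ {z} → z ∈ p → z ≡ x ⊎ z ≡ y) →
        ∣ p ∣ ≡ 2
∣p∣≡2 {p = p} {x} {y} x≢y x∈p y∈p p⊆xy = ≤-antisym upper lower
  where
  open ≤-Reasoning
  ∈⁅⁆ : ∀ {z w : Fin n} → z ≡ w → z ∈ ⁅ w ⁆
  ∈⁅⁆ = Equivalence.from x∈⁅y⁆⇔x≡y
  upper : ∣ p ∣ ≤ 2
  upper = begin
    ∣ p ∣                 ≤⟨ p⊆q⇒∣p∣≤∣q∣ (x∈p∪q⁺ ∘ [ inj₁ ∘ ∈⁅⁆ , inj₂ ∘ ∈⁅⁆ ]′ ∘ p⊆xy) ⟩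
    ∣ ⁅ x ⁆ ∪ ⁅ y ⁆ ∣     ≤⟨ ∣p∪q∣≤∣p∣+∣q∣ ⁅ x ⁆ ⁅ y ⁆ ⟩
    ∣ ⁅ x ⁆ ∣ + ∣ ⁅ y ⁆ ∣ ≡⟨ cong₂ _+_ (∣⁅x⁆∣≡1 x) (∣⁅x⁆∣≡1 y) ⟩
    2                     ∎
  lower : 2 ≤ ∣ p ∣
  lower = ≤-<-trans (≤-<-trans z≤n (x∈p⇒∣p-x∣<∣p∣ (x∈p∧x≢y⇒x∈p-y y∈p (x≢y ∘ sym))))
                    (x∈p⇒∣p-x∣<∣p∣ x∈p)

neighbourhood : Graph n → Fin n → Subset n
neighbourhood G v = tabulate (adj G v)

∈-neighbourhood⁺ : ∀ (G : Graph n) {v u} → adj G v u ≡ true → u ∈ neighbourhood G v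
∈-neighbourhood⁺ G {v} {u} e = lookup⇒[]= u _ (trans (lookup∘tabulate (adj G v) u) e)

sum-indicator≡∣tabulate∣ : (f : Fin n → Bool) →
  sum (List.tabulate (λ u → if f u then 1 else 0)) ≡ ∣ tabulate f ∣
sum-indicator≡∣tabulate∣ {n = zero}  f = refl
sum-indicator≡∣tabulate∣ {n = suc n} f with f zero
... | true  = cong suc (sum-indicator≡∣tabulate∣ (f ∘ suc))
... | false = sum-indicator≡∣tabulate∣ (f ∘ suc)

degree≡∣neighbourhood∣ : ∀ (G : Graph n) v → degree G v ≡ ∣ neighbourhood G v ∣
degree≡∣neighbourhood∣ G v =
  trans (cong sum (map-tabulate id (λ u → if adj G v u then 1 else 0)))
        (sum-indicator≡∣tabulate∣ (adj G v))

adj-sym : ∀ (G : Graph n) {u v} → adj G u v ≡ true → adj G v u ≡ true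
adj-sym G {u} {v} = trans (Graph.sym G v u)

adj⇒≢ : ∀ (G : Graph n) {u v} → adj G u v ≡ true → u ≢ v
adj⇒≢ G {u} e refl with () ← trans (sym (irrefl G u)) e

DistinctNeighbours : Graph n → Fin n → (Fin k → Fin n) → Set
DistinctNeighbours G v ν = Injective _≡_ _≡_ ν × (∀ j → adj G v (ν j) ≡ true)

distinctNeighbours⇒≤degree : ∀ (G : Graph n) {v} {ν : Fin k → Fin n} →
                             DistinctNeighbours G v ν → k ≤ degree G v
distinctNeighbours⇒≤degree G {v} (ν-inj , ν-adj) =
  ≤-trans (injective⇒≤∣p∣ _ ν-inj (∈-neighbourhood⁺ G ∘ ν-adj))
          (≤-reflexive (sym (degree≡∣neighbourhood∣ G v)))

neighbour-listed : ∀ (G : Graph n) {v w} {ν : Fin k → Fin n} → degree G v ≤ k →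
                   DistinctNeighbours G v ν → adj G v w ≡ true → ∃ λ j → w ≡ ν j
neighbour-listed G {v} {w} {ν} deg≤k (ν-inj , ν-adj) v~w with any? (λ j → w ≟ ν j)
... | yes listed  = listed
... | no unlisted =
  ⊥-elim (n≮n _ (≤-trans (distinctNeighbours⇒≤degree G (w∷ν-inj , w∷ν-adj)) deg≤k))
  where
  w∷ν-inj : Injective _≡_ _≡_ (w ◂ ν)
  w∷ν-inj {zero}  {zero}  _ = refl
  w∷ν-inj {zero}  {suc j} e = ⊥-elim (unlisted (j , e))
  w∷ν-inj {suc i} {zero}  e = ⊥-elim (unlisted (i , sym e))
  w∷ν-inj {suc i} {suc j} e = cong suc (ν-inj e)
  w∷ν-adj : ∀ j → adj G v ((w ◂ ν) j) ≡ true
  w∷ν-adj zero    = v~w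
  w∷ν-adj (suc j) = ν-adj j

walk-source∈ : ∀ {G : Graph n} {S u v} → WalkIn G S u v → u ∈ S
walk-source∈ (here u∈S)     = u∈S
walk-source∈ (step u∈S _ _) = u∈S

connected⇒neighbour∈ : ∀ (G : Graph n) {S v w} → InducedConnected G S → v ∈ S → w ∈ S → w ≢ v →
                       ∃ λ u → u ∈ S × adj G v u ≡ true
connected⇒neighbour∈ G {S} conn v∈S w∈S = first-step (conn _ _ v∈S w∈S)
  where
  first-step : ∀ {v w} → WalkIn G S v w → w ≢ v → ∃ λ u → u ∈ S × adj G v u ≡ true
  first-step (here _)        w≢w = ⊥-elim (w≢w refl)
  first-step (step _ v~u walk) _ = _ , walk-source∈ walk , v~u

AtMostOneNeighbourIn : Graph n → Subset n → Set
AtMostOneNeighbourIn G S =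
  ∀ {x y z} → x ∈ S → y ∈ S → z ∈ S → adj G x y ≡ true → adj G x z ≡ true → y ≡ z

edge-spans-connected : ∀ (G : Graph n) {S v w} → InducedConnected G S → AtMostOneNeighbourIn G S →
                       v ∈ S → w ∈ S → adj G v w ≡ true → ∀ {x} → x ∈ S → x ≡ v ⊎ x ≡ w
edge-spans-connected G {S} {v} {w} conn one v∈S w∈S v~w x∈S = go (conn _ _ v∈S x∈S) (inj₁ refl)
  where
  go : ∀ {y x} → WalkIn G S y x → y ≡ v ⊎ y ≡ w → x ≡ v ⊎ x ≡ w
  go (here _)          y∈vw        = y∈vw
  go (step _ v~z walk) (inj₁ refl) = go walk (inj₂ (one v∈S (walk-source∈ walk) w∈S v~z v~w))
  go (step _ w~z walk) (inj₂ refl) =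
    go walk (inj₁ (one w∈S (walk-source∈ walk) v∈S w~z (adj-sym G v~w)))

dominating⇒nonempty : ∀ (G : Graph n) {D} → Dominating G D → Fin n → Nonempty D
dominating⇒nonempty G {D} dom x with x ∈? D
... | yes x∈D = x , x∈D
... | no  x∉D = let w , w∈D , _ = dom x x∉D in w , w∈D

dominating-vertex⇒degree : ∀ (G : Graph n) {D v} → Dominating G D → (∀ {w} → w ∈ D → w ≡ v) →
                           n ∸ 1 ≤ degree G v
dominating-vertex⇒degree {n} G {D} {v} dom D⊆v = begin
  n ∸ 1                 ≡⟨ cong (n ∸_) (sym (∣⁅x⁆∣≡1 v)) ⟩
  n ∸ ∣ ⁅ v ⁆ ∣         ≡⟨ sym (∣∁p∣≡n∸∣p∣ ⁅ v ⁆) ⟩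
  ∣ ∁ ⁅ v ⁆ ∣           ≤⟨ p⊆q⇒∣p∣≤∣q∣ ∁⁅v⁆⊆N ⟩
  ∣ neighbourhood G v ∣ ≡⟨ sym (degree≡∣neighbourhood∣ G v) ⟩
  degree G v            ∎
  where
  open ≤-Reasoning
  ∁⁅v⁆⊆N : ∁ ⁅ v ⁆ ⊆ neighbourhood G v
  ∁⁅v⁆⊆N {u} u∈∁v with dom u (λ u∈D → x∈∁p⇒x∉p u∈∁v (Equivalence.from x∈⁅y⁆⇔x≡y (D⊆v u∈D)))
  ... | w , w∈D , u~w =
    ∈-neighbourhood⁺ G (adj-sym G (subst (λ z → adj G u z ≡ true) (D⊆v w∈D) u~w))

record Regular (H : Graph n) (k : ℕ) : Set where
  field
    neighbour          : Fin n → Fin k → Fin n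
    distinctNeighbours : ∀ i → DistinctNeighbours H i (neighbour i)
    degree≤            : ∀ i → degree H i ≤ k

injective? : (f : Fin k → Fin n) → Dec (Injective _≡_ _≡_ f)
injective? f = map′ (λ inj {i} {j} → inj i j) (λ inj i j → inj)
                    (all? λ i → all? λ j → (f i ≟ f j) →-dec (i ≟ j))

distinctNeighbours? : ∀ (H : Graph n) v (ν : Fin k → Fin n) → Dec (DistinctNeighbours H v ν)
distinctNeighbours? H v ν = injective? ν ×-dec all? (λ j → adj H v (ν j) ≟ᵇ true)

edge-preserving-bijection⇒≅ : ∀ {m} (G : Graph n) (H : Graph m) → (∀ v → degree G v ≤ k) →
  (R : Regular H k) (f : Fin m → Fin n) → Injective _≡_ _≡_ f → (∀ x → ∃ λ i → f i ≡ x) →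
  (∀ i j → adj G (f i) (f (Regular.neighbour R i j)) ≡ true) → G ≅ H
edge-preserving-bijection⇒≅ {n} {m = m} G H degree≤k R f f-inj f-surj f-edges =
  record { bij = mk↔ₛ′ f⁻¹ f f⁻¹∘f f∘f⁻¹ ; preserves = preserves }
  where
  open Regular R
  f⁻¹ : Fin n → Fin m
  f⁻¹ x = proj₁ (f-surj x)
  f∘f⁻¹ : ∀ x → f (f⁻¹ x) ≡ x
  f∘f⁻¹ x = proj₂ (f-surj x)
  f⁻¹∘f : ∀ i → f⁻¹ (f i) ≡ i
  f⁻¹∘f i = f-inj (f∘f⁻¹ (f i))
  H⇒G : ∀ {i j} → adj H i j ≡ true → adj G (f i) (f j) ≡ true
  H⇒G {i} i~j with neighbour-listed H (degree≤ i) (distinctNeighbours i) i~j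
  ... | l , refl = f-edges i l
  f∘ν-distinct : ∀ i → DistinctNeighbours G (f i) (f ∘ neighbour i)
  f∘ν-distinct i = proj₁ (distinctNeighbours i) ∘ f-inj , f-edges i
  G⇒H : ∀ {i j} → adj G (f i) (f j) ≡ true → adj H i j ≡ true
  G⇒H {i} fi~fj with neighbour-listed G (degree≤k (f i)) (f∘ν-distinct i) fi~fj
  ... | l , fj≡fνl =
    subst (λ j → adj H i j ≡ true) (sym (f-inj fj≡fνl)) (proj₂ (distinctNeighbours i) l)
  preserves : ∀ u v → adj H (f⁻¹ u) (f⁻¹ v) ≡ adj G u v
  preserves u v = trans (⇔→≡ (mk⇔ H⇒G G⇒H)) (cong₂ (adj G) (f∘f⁻¹ u) (f∘f⁻¹ v))

-- In Pr6 and in M6, ν i j is the neighbour of i congruent to j modulo 3.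
prism-regular : Regular Pr6 3
prism-regular = record
  { neighbour          = ν
  ; distinctNeighbours = from-yes (all? λ i → distinctNeighbours? Pr6 i (ν i))
  ; degree≤            = from-yes (all? λ i → degree Pr6 i ≤? 3)
  }
  where
  ν : Fin 6 → Fin 3 → Fin 6
  ν 0F = 3F ◂ 1F ◂ 2F ◂ ◆
  ν 1F = 0F ◂ 4F ◂ 2F ◂ ◆
  ν 2F = 0F ◂ 1F ◂ 5F ◂ ◆
  ν 3F = 0F ◂ 4F ◂ 5F ◂ ◆
  ν 4F = 3F ◂ 1F ◂ 5F ◂ ◆
  ν 5F = 3F ◂ 4F ◂ 2F ◂ ◆

möbius-regular : Regular M6 3
möbius-regular = record
  { neighbour          = ν
  ; distinctNeighbours = from-yes (all? λ i → distinctNeighbours? M6 i (ν i))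
  ; degree≤            = from-yes (all? λ i → degree M6 i ≤? 3)
  }
  where
  ν : Fin 6 → Fin 3 → Fin 6
  ν 0F = 3F ◂ 1F ◂ 5F ◂ ◆
  ν 1F = 0F ◂ 4F ◂ 2F ◂ ◆
  ν 2F = 3F ◂ 1F ◂ 5F ◂ ◆
  ν 3F = 0F ◂ 4F ◂ 2F ◂ ◆
  ν 4F = 3F ◂ 1F ◂ 5F ◂ ◆
  ν 5F = 0F ◂ 4F ◂ 2F ◂ ◆

module DisjointConnectedDominatingSets
  {n Δ : ℕ} (2+Δ≤n : 2 + Δ ≤ n) (G : Graph n) (degree≤Δ : ∀ v → degree G v ≤ Δ)
  (D : Fin Δ → Subset n) (connDom : ∀ i → ConnectedDominating G (D i))
  (disjoint : ∀ {i j} → i ≢ j → Disjoint (D i) (D j))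
  where

  private
    variable
      i j : Fin Δ
      v w : Fin n

  nonempty : ∀ i → Nonempty (D i)
  nonempty i = dominating⇒nonempty G (proj₁ (connDom i)) (fromℕ< (≤-trans (s≤s z≤n) 2+Δ≤n))

  other-member : v ∈ D i → ∃ λ w → w ∈ D i × w ≢ v
  other-member {v} {i} v∈D with any? (λ w → (w ∈? D i) ×-dec ¬? (w ≟ v))
  ... | yes found = found
  ... | no  none  = ⊥-elim (n≮n Δ (begin-strict
    Δ           <⟨ ∸-monoˡ-≤ 1 2+Δ≤n ⟩
    n ∸ 1       ≤⟨ dominating-vertex⇒degree G (proj₁ (connDom i)) only-v ⟩
    degree G v  ≤⟨ degree≤Δ v ⟩
    Δ           ∎))
    where
    open ≤-Reasoning
    only-v : ∀ {w} → w ∈ D i → w ≡ v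
    only-v {w} w∈D = decidable-stable (w ≟ v) (λ w≢v → none (w , w∈D , w≢v))

  has-neighbourIn : v ∈ D i → ∀ j → ∃ λ w → w ∈ D j × adj G v w ≡ true
  has-neighbourIn {v} {i} v∈D j with i ≟ j
  ... | yes refl = let w , w∈D , w≢v = other-member v∈D in
                   connected⇒neighbour∈ G (proj₂ (connDom i)) v∈D w∈D w≢v
  ... | no  i≢j  = proj₁ (connDom j) v (disjoint i≢j v v∈D)

  neighbourIn : v ∈ D i → Fin Δ → Fin n
  neighbourIn v∈D j = proj₁ (has-neighbourIn v∈D j)

  neighbourIn-∈ : (v∈D : v ∈ D i) → ∀ j → neighbourIn v∈D j ∈ D j
  neighbourIn-∈ v∈D j = proj₁ (proj₂ (has-neighbourIn v∈D j))

  neighbourIn-adj : (v∈D : v ∈ D i) → ∀ j → adj G v (neighbourIn v∈D j) ≡ true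
  neighbourIn-adj v∈D j = proj₂ (proj₂ (has-neighbourIn v∈D j))

  neighbourIn-injective : (v∈D : v ∈ D i) → Injective _≡_ _≡_ (neighbourIn v∈D)
  neighbourIn-injective v∈D {j} {l} e with j ≟ l
  ... | yes j≡l = j≡l
  ... | no  j≢l = ⊥-elim (disjoint j≢l _ (neighbourIn-∈ v∈D j)
                                          (subst (_∈ D l) (sym e) (neighbourIn-∈ v∈D l)))

  neighbourIn-listed : (v∈D : v ∈ D i) → adj G v w ≡ true → ∃ λ j → w ≡ neighbourIn v∈D j
  neighbourIn-listed v∈D =
    neighbour-listed G (degree≤Δ _) (neighbourIn-injective v∈D , neighbourIn-adj v∈D)

  neighbourIn-unique : (v∈D : v ∈ D i) → adj G v w ≡ true → w ∈ D j → w ≡ neighbourIn v∈D j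
  neighbourIn-unique {j = j} v∈D v~w w∈D with neighbourIn-listed v∈D v~w
  ... | l , refl with l ≟ j
  ... | yes refl = refl
  ... | no  l≢j  = ⊥-elim (disjoint l≢j _ (neighbourIn-∈ v∈D l) w∈D)

  partner : v ∈ D i → Fin n
  partner {i = i} v∈D = neighbourIn v∈D i

  partner-∈ : (v∈D : v ∈ D i) → partner v∈D ∈ D i
  partner-∈ {i = i} v∈D = neighbourIn-∈ v∈D i

  partner-adj : (v∈D : v ∈ D i) → adj G v (partner v∈D) ≡ true
  partner-adj {i = i} v∈D = neighbourIn-adj v∈D i

  partner-involutive : (v∈D : v ∈ D i) → partner (partner-∈ v∈D) ≡ v
  partner-involutive v∈D =
    sym (neighbourIn-unique (partner-∈ v∈D) (adj-sym G (partner-adj v∈D)) v∈D)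

  members : (v∈D : v ∈ D i) → w ∈ D i → w ≡ v ⊎ w ≡ partner v∈D
  members {i = i} v∈D =
    edge-spans-connected G (proj₂ (connDom i)) at-most-one v∈D (partner-∈ v∈D) (partner-adj v∈D)
    where
    at-most-one : AtMostOneNeighbourIn G (D i)
    at-most-one x∈D y∈D z∈D x~y x~z =
      trans (neighbourIn-unique x∈D x~y y∈D) (sym (neighbourIn-unique x∈D x~z z∈D))

  ∣D∣≡2 : v ∈ D i → ∣ D i ∣ ≡ 2
  ∣D∣≡2 v∈D = ∣p∣≡2 (adj⇒≢ G (partner-adj v∈D)) v∈D (partner-∈ v∈D) (members v∈D)

  covered : Fin Δ → ∀ x → ∃ λ j → x ∈ D j
  covered i x with x ∈? D i
  ... | yes x∈D = i , x∈D
  ... | no  x∉D with proj₁ (connDom i) x x∉D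
  ... | u , u∈D , x~u with neighbourIn-listed u∈D (adj-sym G x~u)
  ... | j , refl = j , neighbourIn-∈ u∈D j

  partners-adjacent : (v∈D : v ∈ D i) (w∈D : w ∈ D j) → adj G v w ≡ true →
                      adj G (partner v∈D) (partner w∈D) ≡ true
  partners-adjacent {i = i} {w = w} {j = j} v∈D w∈D v~w = adjacent (members w∈D y∈D)
    where
    v'∈D : partner v∈D ∈ D i
    v'∈D = partner-∈ v∈D
    y : Fin n
    y = neighbourIn v'∈D j
    y∈D : y ∈ D j
    y∈D = neighbourIn-∈ v'∈D j
    v'~y : adj G (partner v∈D) y ≡ true
    v'~y = neighbourIn-adj v'∈D j
    adjacent : y ≡ w ⊎ y ≡ partner w∈D → adj G (partner v∈D) (partner w∈D) ≡ true
    adjacent (inj₂ y≡w') = subst (λ z → adj G (partner v∈D) z ≡ true) y≡w' v'~y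
    -- otherwise w would have the two neighbours v and partner v∈D in D i
    adjacent (inj₁ y≡w)  = ⊥-elim (adj⇒≢ G (partner-adj v∈D) (trans
      (neighbourIn-unique w∈D (adj-sym G v~w) v∈D)
      (sym (neighbourIn-unique w∈D (adj-sym G (subst (λ z → adj G _ z ≡ true) y≡w v'~y)) v'∈D))))

disjoint-triple : {A B C : Subset n} → Disjoint A B → Disjoint A C → Disjoint B C →
                  ∀ {i j} → i ≢ j → Disjoint ((A ◂ B ◂ C ◂ ◆) i) ((A ◂ B ◂ C ◂ ◆) j)
disjoint-triple A∩B A∩C B∩C {0F} {0F} 0≢0 = ⊥-elim (0≢0 refl)
disjoint-triple A∩B A∩C B∩C {0F} {1F} _   = A∩B
disjoint-triple A∩B A∩C B∩C {0F} {2F} _   = A∩C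
disjoint-triple A∩B A∩C B∩C {1F} {0F} _   = λ v v∈B v∈A → A∩B v v∈A v∈B
disjoint-triple A∩B A∩C B∩C {1F} {1F} 1≢1 = ⊥-elim (1≢1 refl)
disjoint-triple A∩B A∩C B∩C {1F} {2F} _   = B∩C
disjoint-triple A∩B A∩C B∩C {2F} {0F} _   = λ v v∈C v∈A → A∩C v v∈A v∈C
disjoint-triple A∩B A∩C B∩C {2F} {1F} _   = λ v v∈C v∈B → B∩C v v∈B v∈C
disjoint-triple A∩B A∩C B∩C {2F} {2F} 2≢2 = ⊥-elim (2≢2 refl)

module ThreeDisjointConnectedDominatingSets
  {n : ℕ} (n≥5 : n ≥ 5) (G : Graph n) (degree≤3 : ∀ v → degree G v ≤ 3)
  (D : Fin 3 → Subset n) (connDom : ∀ i → ConnectedDominating G (D i))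
  (disjoint : ∀ {i j} → i ≢ j → Disjoint (D i) (D j))
  where

  open DisjointConnectedDominatingSets n≥5 G degree≤3 D connDom disjoint

  a b c : Fin n
  a∈D : a ∈ D 0F
  b∈D : b ∈ D 1F
  c∈D : c ∈ D 2F
  a   = proj₁ (nonempty 0F)
  a∈D = proj₂ (nonempty 0F)
  b   = neighbourIn a∈D 1F
  b∈D = neighbourIn-∈ a∈D 1F
  c   = neighbourIn b∈D 2F
  c∈D = neighbourIn-∈ b∈D 2F

  representative : ∀ j → Nonempty (D j)
  representative 0F = a , a∈D
  representative 1F = b , b∈D
  representative 2F = c , c∈D

  vertex : Fin 2 × Fin 3 → Fin n
  vertex (0F , j) = proj₁ (representative j)
  vertex (1F , j) = partner (proj₂ (representative j))

  vertex-∈ : ∀ s j → vertex (s , j) ∈ D j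
  vertex-∈ 0F j = proj₂ (representative j)
  vertex-∈ 1F j = partner-∈ (proj₂ (representative j))

  vertex-injective : Injective _≡_ _≡_ vertex
  vertex-injective {s , j} {t , l} e with j ≟ l
  ... | no  j≢l  = ⊥-elim (disjoint j≢l _ (vertex-∈ s j) (subst (_∈ D l) (sym e) (vertex-∈ t l)))
  ... | yes refl = cong (_, j) (same-side s t e)
    where
    same-side : ∀ s t → vertex (s , j) ≡ vertex (t , j) → s ≡ t
    same-side 0F 0F _ = refl
    same-side 0F 1F e = ⊥-elim (adj⇒≢ G (partner-adj (proj₂ (representative j))) e)
    same-side 1F 0F e = ⊥-elim (adj⇒≢ G (partner-adj (proj₂ (representative j))) (sym e))
    same-side 1F 1F _ = refl

  vertex-surjective : ∀ x → ∃ λ sj → vertex sj ≡ x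
  vertex-surjective x with covered 0F x
  ... | j , x∈D with members (proj₂ (representative j)) x∈D
  ... | inj₁ x≡v  = (0F , j) , sym x≡v
  ... | inj₂ x≡v' = (1F , j) , sym x≡v'

  -- Vertex k of Pr6 and M6 goes to the vertex of D (k mod 3) on side k div 3, side 1 holding
  -- the partners.
  φ : Fin 6 → Fin n
  φ = vertex ∘ remQuot 3

  φ-injective : Injective _≡_ _≡_ φ
  φ-injective {k} {l} e = begin
    k                                 ≡⟨ combine-remQuot {2} 3 k ⟨
    uncurry combine (remQuot {2} 3 k) ≡⟨ cong (uncurry combine) same-vertex ⟩
    uncurry combine (remQuot {2} 3 l) ≡⟨ combine-remQuot {2} 3 l ⟩
    l                                 ∎
    where
    open ≡-Reasoning
    same-vertex : remQuot 3 k ≡ remQuot 3 l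
    same-vertex = vertex-injective {remQuot 3 k} {remQuot 3 l} e

  φ-surjective : ∀ x → ∃ λ k → φ k ≡ x
  φ-surjective x with vertex-surjective x
  ... | (s , j) , e = combine s j , trans (cong vertex (remQuot-combine s j)) e

  cardinality : ∀ i → ∣ D i ∣ ≡ 2
  cardinality i = ∣D∣≡2 (vertex-∈ 0F i)

  a~b : adj G a b ≡ true
  a~b = neighbourIn-adj a∈D 1F

  b~c : adj G b c ≡ true
  b~c = neighbourIn-adj b∈D 2F

  a'~b' : adj G (partner a∈D) (partner b∈D) ≡ true
  a'~b' = partners-adjacent a∈D b∈D a~b

  b'~c' : adj G (partner b∈D) (partner c∈D) ≡ true
  b'~c' = partners-adjacent b∈D c∈D b~c

  prism-edges : adj G a c ≡ true →
                ∀ i j → adj G (φ i) (φ (Regular.neighbour prism-regular i j)) ≡ true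
  prism-edges a~c 0F 0F = partner-adj a∈D
  prism-edges a~c 0F 1F = a~b
  prism-edges a~c 0F 2F = a~c
  prism-edges a~c 1F 0F = adj-sym G a~b
  prism-edges a~c 1F 1F = partner-adj b∈D
  prism-edges a~c 1F 2F = b~c
  prism-edges a~c 2F 0F = adj-sym G a~c
  prism-edges a~c 2F 1F = adj-sym G b~c
  prism-edges a~c 2F 2F = partner-adj c∈D
  prism-edges a~c 3F 0F = adj-sym G (partner-adj a∈D)
  prism-edges a~c 3F 1F = a'~b'
  prism-edges a~c 3F 2F = partners-adjacent a∈D c∈D a~c
  prism-edges a~c 4F 0F = adj-sym G a'~b'
  prism-edges a~c 4F 1F = adj-sym G (partner-adj b∈D)
  prism-edges a~c 4F 2F = b'~c'
  prism-edges a~c 5F 0F = adj-sym G (partners-adjacent a∈D c∈D a~c)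
  prism-edges a~c 5F 1F = adj-sym G b'~c'
  prism-edges a~c 5F 2F = adj-sym G (partner-adj c∈D)

  a'~c : adj G a (partner c∈D) ≡ true → adj G (partner a∈D) c ≡ true
  a'~c a~c' = subst (λ x → adj G (partner a∈D) x ≡ true) (partner-involutive c∈D)
                    (partners-adjacent a∈D (partner-∈ c∈D) a~c')

  möbius-edges : adj G a (partner c∈D) ≡ true →
                 ∀ i j → adj G (φ i) (φ (Regular.neighbour möbius-regular i j)) ≡ true
  möbius-edges a~c' 0F 0F = partner-adj a∈D
  möbius-edges a~c' 0F 1F = a~b
  möbius-edges a~c' 0F 2F = a~c'
  möbius-edges a~c' 1F 0F = adj-sym G a~b
  möbius-edges a~c' 1F 1F = partner-adj b∈D
  möbius-edges a~c' 1F 2F = b~c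
  möbius-edges a~c' 2F 0F = adj-sym G (a'~c a~c')
  möbius-edges a~c' 2F 1F = adj-sym G b~c
  möbius-edges a~c' 2F 2F = partner-adj c∈D
  möbius-edges a~c' 3F 0F = adj-sym G (partner-adj a∈D)
  möbius-edges a~c' 3F 1F = a'~b'
  möbius-edges a~c' 3F 2F = a'~c a~c'
  möbius-edges a~c' 4F 0F = adj-sym G a'~b'
  möbius-edges a~c' 4F 1F = adj-sym G (partner-adj b∈D)
  möbius-edges a~c' 4F 2F = b'~c'
  möbius-edges a~c' 5F 0F = adj-sym G a~c'
  möbius-edges a~c' 5F 1F = adj-sym G b'~c'
  möbius-edges a~c' 5F 2F = adj-sym G (partner-adj c∈D)

  a~c⊎a~c' : adj G a c ≡ true ⊎ adj G a (partner c∈D) ≡ true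
  a~c⊎a~c' = Sum.map adjacent adjacent (members c∈D (neighbourIn-∈ a∈D 2F))
    where
    adjacent : ∀ {x} → neighbourIn a∈D 2F ≡ x → adj G a x ≡ true
    adjacent refl = neighbourIn-adj a∈D 2F

  prism-or-möbius : G ≅ Pr6 ⊎ G ≅ M6
  prism-or-möbius = Sum.map
    (edge-preserving-bijection⇒≅ G Pr6 degree≤3 prism-regular φ φ-injective φ-surjective
      ∘ prism-edges)
    (edge-preserving-bijection⇒≅ G M6 degree≤3 möbius-regular φ φ-injective φ-surjective
      ∘ möbius-edges)
    a~c⊎a~c'

corollary2 : (n : ℕ) → n ≥ 5 → (G : Graph n) → Subcubic G →
    (D₁ D₂ D₃ : Subset n) →
    ConnectedDominating G D₁ → ConnectedDominating G D₂ → ConnectedDominating G D₃ →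
    Disjoint D₁ D₂ → Disjoint D₁ D₃ → Disjoint D₂ D₃ →
    (∣ D₁ ∣ ≡ 2 × ∣ D₂ ∣ ≡ 2 × ∣ D₃ ∣ ≡ 2) × (G ≅ Pr6 ⊎ G ≅ M6)
corollary2 n n≥5 G (_ , degree≤3) D₁ D₂ D₃ cd₁ cd₂ cd₃ D₁∩D₂ D₁∩D₃ D₂∩D₃ =
  (cardinality 0F , cardinality 1F , cardinality 2F) , prism-or-möbius
  where
  connDom : ∀ i → ConnectedDominating G ((D₁ ◂ D₂ ◂ D₃ ◂ ◆) i)
  connDom 0F = cd₁
  connDom 1F = cd₂
  connDom 2F = cd₃
  open ThreeDisjointConnectedDominatingSets n≥5 G degree≤3 (D₁ ◂ D₂ ◂ D₃ ◂ ◆) connDom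
         (disjoint-triple D₁∩D₂ D₁∩D₃ D₂∩D₃)
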